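{- Let $G$ be a graph, $T$ a rooted tree with root $r$, and $\mathrm{map}\colon V(T)\to V(G)$ a valid mapping. Let $L,d$ be positive integers and let $\ell_G\colon V(G)\to[L]\cup\{\infty\}$ be a partial layer assignment of $G$ with out-degree $d$ such that $\ell_G(\mathrm{map}(r))\ne\infty$. Let $k\ge d$ be a positive integer and $T_{\mathrm{pruned}}=\mathrm{LocalPrune}(T,k)$. Then $|V(T_{\mathrm{pruned}})|\le\mathrm{NumPathsIn}_{G,\ell_G}(\mathrm{map}(r))$.
   Context: $[L]=\{1,\dots,L\}$, $\infty$ exceeds every integer. A partial layer assignment of $G$ with out-degree $d$ is a function $\ell\colon V(G)\to[L]\cup\{\infty\}$ such that for every $v$ with $\ell(v)\ne\infty$, $|\{u\in N_G(v):\ell(u)\ge\ell(v)\}|\le d$. A path $(v_1,\dots,v_k)$ ($k\ge1$) is strictly increasing w.r.t. $\ell$ if $\ell(v_1)<\dots<\ell(v_k)<\infty$; $\mathrm{NumPathsIn}_{G,\ell}(v)$ is the number of distinct strictly increasing paths ending at $v$. A mapping $\mathrm{map}\colon V(T)\to V(G)$ is valid if (1) every tree edge $(x,y)$ maps to an edge $\{\mathrm{map}(x),\mathrm{map}(y)\}$ of $G$, and (2) distinct children of the same tree node have distinct images. $\mathrm{LocalPrune}(T,k)$, for a rooted tree $T$ with root $r$: if $r$ has at most $k$ children, return the single-node tree $\{r\}$; otherwise, for each child $c$ of $r$ compute $T_{c,\mathrm{pruned}}=\mathrm{LocalPrune}(T_c,k)$ ($T_c$ the subtree rooted at $c$), discard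 the $k$ largest (by number of nodes, ties broken arbitrarily) of these, and return the tree with root $r$ whose child subtrees are the remaining $T_{c,\mathrm{pruned}}$. -}

module Defs where

open import Data.Nat using (ℕ; zero; suc; _≤_; _<_; _≤ᵇ_; _<ᵇ_)
open import Data.Bool using (Bool; true; false; _∧_)
open import Data.Fin using (Fin; toℕ; _≟_)
open import Data.List using (List; []; _∷_; _++_; length; map; concatMap; allFin)
open import Data.Nat.ListAction using (sum)
open import Data.List.Relation.Unary.All using (All)
open import Data.List.Relation.Unary.Unique.Propositional using (Unique)
open import Data.List.Relation.Binary.Pointwise using (Pointwise)
open import Data.List.Relation.Binary.Permutation.Propositional using (_↭_)
open import Relation.Nullary.Decidable using (⌊_⌋)
open import Relation.Binary.PropositionalEquality using (_≡_)

record Graph : Set where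
  field
    n      : ℕ
    adj    : Fin n → Fin n → Bool
    sym    : ∀ u v → adj u v ≡ adj v u
    irrefl : ∀ v → adj v v ≡ false

open Graph public

-- Layers  [L] ∪ {∞}.  Layer j ∈ [L] = {1..L} is encoded as  fin (j-1)
-- with j-1 : Fin L; ∞ exceeds every integer.

data Layer (L : ℕ) : Set where
  fin : Fin L → Layer L
  ∞   : Layer L

_≤ᴸ_ : ∀ {L} → Layer L → Layer L → Bool
fin i ≤ᴸ fin j = toℕ i ≤ᵇ toℕ j
fin i ≤ᴸ ∞     = true
∞     ≤ᴸ fin j = false
∞     ≤ᴸ ∞     = true

_<ᴸ_ : ∀ {L} → Layer L → Layer L → Bool
fin i <ᴸ fin j = toℕ i <ᵇ toℕ j
fin i <ᴸ ∞     = true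
∞     <ᴸ _     = false

countᵇ : ∀ {A : Set} → (A → Bool) → List A → ℕ
countᵇ p []       = 0
countᵇ p (x ∷ xs) with p x
... | true  = suc (countᵇ p xs)
... | false = countᵇ p xs

IsPartialLayerAssignment : (G : Graph) (L d : ℕ) → (Fin (n G) → Layer L) → Set
IsPartialLayerAssignment G L d ℓ =
  ∀ v → (ℓ v ≡ ∞ → Data.Empty.⊥) →
    countᵇ (λ u → adj G v u ∧ (ℓ v ≤ᴸ ℓ u)) (allFin (n G)) ≤ d
  where import Data.Empty

module _ (G : Graph) {L : ℕ} (ℓ : Fin (n G) → Layer L) where

  incPathFrom : Fin (n G) → List (Fin (n G)) → Fin (n G) → Bool
  incPathFrom x []       v = (ℓ x <ᴸ ∞) ∧ ⌊ x ≟ v ⌋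
  incPathFrom x (y ∷ ys) v = adj G x y ∧ ((ℓ x <ᴸ ℓ y) ∧ incPathFrom y ys v)

  seqsOfLength : ℕ → List (List (Fin (n G)))
  seqsOfLength zero    = [] ∷ []
  seqsOfLength (suc m) = concatMap (λ x → map (x ∷_) (seqsOfLength m)) (allFin (n G))

  numPathsOfLength : Fin (n G) → ℕ → ℕ
  numPathsOfLength v m = countᵇ (λ xs → isInc xs) (seqsOfLength m)
    where
      isInc : List (Fin (n G)) → Bool
      isInc []       = false
      isInc (x ∷ xs) = incPathFrom x xs v

  -- Such a path has pairwise distinct vertices (layers strictly
  -- increase), hence at most n vertices; we count sequences of lengths 1..n.
  NumPathsIn : Fin (n G) → ℕ
  NumPathsIn v = sum (map (λ m → numPathsOfLength v (suc m)) (Data.List.upTo (n G)))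
    where import Data.List

-- Rooted trees together with a map to V(G): each tree node is labelled by
-- its image  map(x).  (Children form a list; V(T) = set of tree nodes.)

data LTree (V : Set) : Set where
  node : V → List (LTree V) → LTree V

label : ∀ {V} → LTree V → V
label (node v _) = v

children : ∀ {V} → LTree V → List (LTree V)
children (node _ ts) = ts

mutual
  size : ∀ {V} → LTree V → ℕ
  size (node _ ts) = suc (sizes ts)

  sizes : ∀ {V} → List (LTree V) → ℕ
  sizes []       = 0
  sizes (t ∷ ts) = size t Data.Nat.+ sizes ts
    where import Data.Nat

mutual
  Valid : (G : Graph) → LTree (Fin (n G)) → Set
  Valid G (node v ts) =
    All (λ t → adj G v (label t) ≡ true) ts
    Data.Product.× (Unique (map label ts) Data.Product.× ValidAll G ts)
    where import Data.Product

  ValidAll : (G : Graph) → List (LTree (Fin (n G))) → Set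
  ValidAll G []       = Data.Unit.⊤ where import Data.Unit
  ValidAll G (t ∷ ts) = Valid G t Data.Product.× ValidAll G ts
    where import Data.Product

-- LocalPrune(T,k) as a relation  LocalPrune k T T'  ("T' is a possible
-- output of LocalPrune(T,k)"), covering every way of breaking ties.

data LocalPrune {V : Set} (k : ℕ) : LTree V → LTree V → Set where
  few  : ∀ {r ts} → length ts ≤ k → LocalPrune k (node r ts) (node r [])
  many : ∀ {r ts} (ps big rest : List (LTree V)) →
         k < length ts →
         Pointwise (LocalPrune k) ts ps →
         ps ↭ (big ++ rest) →
         length big ≡ k →
         All (λ b → All (λ c → size c ≤ size b) rest) big →
         LocalPrune k (node r ts) (node r rest)

{-# OPTIONS --safe #-}
-- The layer of the root image r is finite, so at most d ≤ k
-- children of the root have images in a layer ≥ ℓ(r): their images are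
-- distinct neighbours of r. Discarding the k largest pruned subtrees hence
-- leaves a total size at most that of the pruned subtrees of the children
-- whose images u lie strictly below r, and by induction the subtree at such a
-- child has size ≤ NumPathsIn(u). Appending r to the increasing paths ending
-- at these distinct lower neighbours gives distinct increasing paths ending
-- at r, and the one-vertex path (r) accounts for the root itself.
module Submission where

open import Defs hiding (sym)
open import Data.Bool using (Bool; true; false; not; _∧_; T)
open import Data.Bool.Properties using (T-∧; T-≡)
open import Data.Empty using (⊥-elim)
open import Data.Fin using (Fin; toℕ; _≟_)
open import Data.List using (List; []; _∷_; _++_; _∷ʳ_; [_]; length; map; concat; allFin; upTo)
open import Data.List.Properties using (map-++; map-∘; map-cong; map-applyUpTo; upTo-∷ʳ; length-tabulate)
open import Data.List.Extrema.Nat using (max; xs≤max; max≤v⁺)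
open import Data.List.Membership.Propositional using (_∈_)
open import Data.List.Membership.Propositional.Properties using (∈-allFin)
open import Data.List.Relation.Binary.Permutation.Propositional using (_↭_)
open import Data.List.Relation.Binary.Permutation.Propositional.Properties using (map⁺)
open import Data.List.Relation.Binary.Pointwise using (Pointwise; []; _∷_)
open import Data.List.Relation.Binary.Subset.Propositional using (_⊆_)
open import Data.List.Relation.Unary.All as All using (All; []; _∷_)
import Data.List.Relation.Unary.All.Properties as All
open import Data.List.Relation.Unary.AllPairs using ([]; _∷_)
open import Data.List.Relation.Unary.Any using (here; there)
open import Data.List.Relation.Unary.Unique.Propositional using (Unique)
open import Data.Nat using (ℕ; zero; suc; _+_; _*_; _≤_; _<_; z≤n; z<s)
open import Data.Nat.ListAction using (sum)
open import Data.Nat.ListAction.Properties using (sum-++; sum-↭)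
open import Data.Nat.Properties hiding (_≟_)
open import Algebra.Properties.CommutativeSemigroup +-commutativeSemigroup using (interchange)
open import Data.Product using (_×_; _,_; proj₁; proj₂)
open import Function using (_∘_)
open import Function.Bundles using (Equivalence)
open import Relation.Binary using (DecidableEquality)
open import Relation.Binary.PropositionalEquality using (_≡_; _≢_; refl; sym; trans; cong; cong₂; subst; subst₂; module ≡-Reasoning)
open import Relation.Nullary using (¬_; yes; no)
open import Relation.Nullary.Decidable using (⌊_⌋; fromWitness; toWitness)

∑ : {A : Set} → (A → ℕ) → List A → ℕ
∑ f xs = sum (map f xs)

∑-syntax : {A : Set} → List A → (A → ℕ) → ℕ
∑-syntax xs f = ∑ f xs

-- Level 6.5: the body of ∑[ x ← xs ] extends over products but not over sums.
infix 6.5 ∑-syntax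
syntax ∑-syntax xs (λ x → e) = ∑[ x ← xs ] e

⟦_⟧ : Bool → ℕ
⟦ true ⟧  = 1
⟦ false ⟧ = 0

module _ {A : Set} where

  ∑-cong : ∀ {f g : A → ℕ} → (∀ x → f x ≡ g x) → ∀ xs → ∑ f xs ≡ ∑ g xs
  ∑-cong f≗g xs = cong sum (map-cong f≗g xs)

  ∑-mono-≤ : ∀ {f g : A → ℕ} {xs} → All (λ x → f x ≤ g x) xs → ∑ f xs ≤ ∑ g xs
  ∑-mono-≤ []         = z≤n
  ∑-mono-≤ (le ∷ les) = +-mono-≤ le (∑-mono-≤ les)

  ∑-zero : ∀ {f : A → ℕ} {xs} → All (λ x → f x ≡ 0) xs → ∑ f xs ≡ 0
  ∑-zero []         = refl
  ∑-zero (eq ∷ eqs) = cong₂ _+_ eq (∑-zero eqs)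

  ∑-+ : ∀ (f g : A → ℕ) xs → ∑[ x ← xs ] (f x + g x) ≡ ∑ f xs + ∑ g xs
  ∑-+ f g []       = refl
  ∑-+ f g (x ∷ xs) =
    trans (cong (f x + g x +_) (∑-+ f g xs)) (interchange (f x) (g x) (∑ f xs) (∑ g xs))

  ∑-++ : ∀ (f : A → ℕ) xs ys → ∑ f (xs ++ ys) ≡ ∑ f xs + ∑ f ys
  ∑-++ f xs ys = trans (cong sum (map-++ f xs ys)) (sum-++ (map f xs) (map f ys))

  ∑-↭ : ∀ (f : A → ℕ) {xs ys} → xs ↭ ys → ∑ f xs ≡ ∑ f ys
  ∑-↭ f xs↭ys = sum-↭ (map⁺ f xs↭ys)

  ∑-*ˡ : ∀ c (f : A → ℕ) xs → c * ∑ f xs ≡ ∑[ x ← xs ] c * f x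
  ∑-*ˡ c f []       = *-zeroʳ c
  ∑-*ˡ c f (x ∷ xs) = trans (*-distribˡ-+ c (f x) (∑ f xs)) (cong (c * f x +_) (∑-*ˡ c f xs))

  ∑-*ʳ : ∀ c (f : A → ℕ) xs → ∑ f xs * c ≡ ∑[ x ← xs ] f x * c
  ∑-*ʳ c f []       = refl
  ∑-*ʳ c f (x ∷ xs) = trans (*-distribʳ-+ c (f x) (∑ f xs)) (cong (f x * c +_) (∑-*ʳ c f xs))

  ∑-∈ : ∀ (f : A → ℕ) {x xs} → x ∈ xs → f x ≤ ∑ f xs
  ∑-∈ f (here refl)            = m≤m+n _ _
  ∑-∈ f {xs = y ∷ _} (there p) = ≤-trans (∑-∈ f p) (m≤n+m _ (f y))

  ∑-mono-< : ∀ {f g : A → ℕ} {y xs} → All (λ x → f x ≤ g x) xs → y ∈ xs → f y < g y →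
             ∑ f xs < ∑ g xs
  ∑-mono-< (_ ∷ les) (here refl) lt = +-mono-<-≤ lt (∑-mono-≤ les)
  ∑-mono-< (le ∷ les) (there p)  lt = +-mono-≤-< le (∑-mono-< les p lt)

  ∑-const-1 : ∀ (xs : List A) → ∑[ _ ← xs ] 1 ≡ length xs
  ∑-const-1 []       = refl
  ∑-const-1 (_ ∷ xs) = cong suc (∑-const-1 xs)

  ∑⟦⟧≤length : ∀ (p : A → Bool) xs → ∑[ x ← xs ] ⟦ p x ⟧ ≤ length xs
  ∑⟦⟧≤length p xs =
    ≤-trans (∑-mono-≤ (All.universal (⟦⟧≤1 ∘ p) xs)) (≤-reflexive (∑-const-1 xs))
    where
      ⟦⟧≤1 : ∀ b → ⟦ b ⟧ ≤ 1
      ⟦⟧≤1 true  = ≤-refl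
      ⟦⟧≤1 false = z≤n

∑-map : ∀ {A B : Set} (f : B → ℕ) (g : A → B) xs → ∑ f (map g xs) ≡ ∑ (f ∘ g) xs
∑-map f g xs = cong sum (sym (map-∘ xs))

∑-concat : ∀ {A : Set} (f : A → ℕ) xss → ∑ f (concat xss) ≡ ∑ (∑ f) xss
∑-concat f []         = refl
∑-concat f (xs ∷ xss) = trans (∑-++ f xs (concat xss)) (cong (∑ f xs +_) (∑-concat f xss))

∑-comm : ∀ {A B : Set} (f : A → B → ℕ) xs ys →
         ∑[ x ← xs ] ∑[ y ← ys ] f x y ≡ ∑[ y ← ys ] ∑[ x ← xs ] f x y
∑-comm f []       ys = sym (∑-zero (All.universal (λ _ → refl) ys))
∑-comm f (x ∷ xs) ys =
  trans (cong (∑ (f x) ys +_) (∑-comm f xs ys)) (sym (∑-+ (f x) (λ y → ∑[ x ← xs ] f x y) ys))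

∑-upTo-suc : ∀ (f : ℕ → ℕ) n → ∑ f (upTo (suc n)) ≡ f 0 + ∑[ m ← upTo n ] f (suc m)
∑-upTo-suc f n =
  cong (λ xs → f 0 + sum xs) (trans (map-applyUpTo suc f n) (sym (map-applyUpTo (λ m → m) (f ∘ suc) n)))

∑-upTo-∷ʳ : ∀ (f : ℕ → ℕ) n → ∑ f (upTo (suc n)) ≡ ∑ f (upTo n) + f n
∑-upTo-∷ʳ f n = begin
  ∑ f (upTo (suc n))        ≡⟨ cong (∑ f) (sym (upTo-∷ʳ n)) ⟩
  ∑ f (upTo n ∷ʳ n)         ≡⟨ ∑-++ f (upTo n) [ n ] ⟩
  ∑ f (upTo n) + (f n + 0)  ≡⟨ cong (∑ f (upTo n) +_) (+-identityʳ (f n)) ⟩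
  ∑ f (upTo n) + f n        ∎
  where open ≡-Reasoning

countᵇ≡∑ : ∀ {A : Set} (p : A → Bool) xs → countᵇ p xs ≡ ∑[ x ← xs ] ⟦ p x ⟧
countᵇ≡∑ p []       = refl
countᵇ≡∑ p (x ∷ xs) with p x
... | true  = cong suc (countᵇ≡∑ p xs)
... | false = countᵇ≡∑ p xs

T-∧⁻ : ∀ a {b} → T (a ∧ b) → T a × T b
T-∧⁻ a = Equivalence.to (T-∧ {a})

T-∧⁺ : ∀ {a b} → T a × T b → T (a ∧ b)
T-∧⁺ = Equivalence.from T-∧

T-not⇒¬T : ∀ {b} → T (not b) → ¬ T b
T-not⇒¬T {false} _ ()

⟦⟧-true : ∀ {b} → T b → ⟦ b ⟧ ≡ 1
⟦⟧-true {true} _ = refl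

⟦⟧-false : ∀ {b} → ¬ T b → ⟦ b ⟧ ≡ 0
⟦⟧-false {true}  ¬b = ⊥-elim (¬b _)
⟦⟧-false {false} _  = refl

⟦⟧-mono : ∀ {a b} → (T a → T b) → ⟦ a ⟧ ≤ ⟦ b ⟧
⟦⟧-mono {false} _   = z≤n
⟦⟧-mono {true}  a⇒b = ≤-reflexive (sym (⟦⟧-true (a⇒b _)))

⟦⟧*-mono : ∀ {a b c d} → (T a → T b → T c × T d) → ⟦ a ⟧ * ⟦ b ⟧ ≤ ⟦ c ⟧ * ⟦ d ⟧
⟦⟧*-mono {false}                        _ = z≤n
⟦⟧*-mono {true} {false}                 _ = z≤n
⟦⟧*-mono {true} {true} {true}  {true}   _ = ≤-refl
⟦⟧*-mono {true} {true} {true}  {false}  h = ⊥-elim (proj₂ (h _ _))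
⟦⟧*-mono {true} {true} {false}          h = ⊥-elim (proj₁ (h _ _))

⟦⟧*-monoʳ : ∀ {b m n} → (T b → m ≤ n) → ⟦ b ⟧ * m ≤ ⟦ b ⟧ * n
⟦⟧*-monoʳ {true}  m≤n = *-monoʳ-≤ 1 (m≤n _)
⟦⟧*-monoʳ {false} _   = z≤n

⟦⟧*-split : ∀ b m → m ≡ ⟦ b ⟧ * m + ⟦ not b ⟧ * m
⟦⟧*-split true  m = sym (trans (cong (_+ 0) (+-identityʳ m)) (+-identityʳ m))
⟦⟧*-split false m = sym (+-identityʳ m)

⟦not⟧+⟦⟧≡1 : ∀ b → ⟦ not b ⟧ + ⟦ b ⟧ ≡ 1
⟦not⟧+⟦⟧≡1 true  = refl
⟦not⟧+⟦⟧≡1 false = refl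

module _ {A : Set} (_≟ᴬ_ : DecidableEquality A) where

  ∑-Unique-≟≤1 : ∀ {U} → Unique U → ∀ w → ∑[ u ← U ] ⟦ ⌊ u ≟ᴬ w ⌋ ⟧ ≤ 1
  ∑-Unique-≟≤1 []                    w = z≤n
  ∑-Unique-≟≤1 {u ∷ U} (u∉U ∷ uniq) w with u ≟ᴬ w
  ... | yes refl = ≤-reflexive (cong suc (∑-zero (All.map u≢⇒δ≡0 u∉U)))
    where
      u≢⇒δ≡0 : ∀ {u′} → u ≢ u′ → ⟦ ⌊ u′ ≟ᴬ u ⌋ ⟧ ≡ 0
      u≢⇒δ≡0 u≢u′ = ⟦⟧-false (λ u′≡u → u≢u′ (sym (toWitness u′≡u)))
  ... | no _     = ∑-Unique-≟≤1 uniq w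

  ∑-Unique-⊆ : ∀ (h : A → ℕ) {U V} → Unique U → U ⊆ V → ∑ h U ≤ ∑ h V
  ∑-Unique-⊆ h {U} {V} uniq U⊆V = begin
    ∑ h U
      ≤⟨ ∑-mono-≤ (All.tabulate (λ u∈U → δ-∑ (U⊆V u∈U))) ⟩
    ∑[ u ← U ] ∑[ w ← V ] δ u w * h w
      ≡⟨ ∑-comm (λ u w → δ u w * h w) U V ⟩
    ∑[ w ← V ] ∑[ u ← U ] δ u w * h w
      ≡⟨ ∑-cong (λ w → sym (∑-*ʳ (h w) (λ u → δ u w) U)) V ⟩
    ∑[ w ← V ] (∑[ u ← U ] δ u w) * h w
      ≤⟨ ∑-mono-≤ (All.universal (λ w → *-monoˡ-≤ (h w) (∑-Unique-≟≤1 uniq w)) V) ⟩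
    ∑[ w ← V ] 1 * h w
      ≡⟨ ∑-cong (λ w → *-identityˡ (h w)) V ⟩
    ∑ h V ∎
    where
      open ≤-Reasoning
      δ : A → A → ℕ
      δ u w = ⟦ ⌊ u ≟ᴬ w ⌋ ⟧
      δ-∑ : ∀ {u} → u ∈ V → h u ≤ ∑[ w ← V ] δ u w * h w
      δ-∑ {u} u∈V = begin
        h u              ≡⟨ sym (*-identityˡ (h u)) ⟩
        1 * h u          ≡⟨ cong (_* h u) (sym (⟦⟧-true {⌊ u ≟ᴬ u ⌋} (fromWitness refl))) ⟩
        δ u u * h u      ≤⟨ ∑-∈ (λ w → δ u w * h w) u∈V ⟩
        ∑[ w ← V ] δ u w * h w ∎

module _ {A : Set} (w : A → ℕ) where

  ∑-*-dominated : ∀ (α β : A → ℕ) {xs ys} → All (λ y → All (λ x → w x ≤ w y) xs) ys →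
                  ∑ α xs ≤ ∑ β ys → ∑[ x ← xs ] α x * w x ≤ ∑[ y ← ys ] β y * w y
  ∑-*-dominated α β {xs} {ys} ys≥xs ∑α≤∑β = begin
    ∑[ x ← xs ] α x * w x  ≤⟨ ∑-mono-≤ (All.map (λ {x} → *-monoʳ-≤ (α x)) w≤M) ⟩
    ∑[ x ← xs ] α x * M    ≡⟨ sym (∑-*ʳ M α xs) ⟩
    ∑ α xs * M             ≤⟨ *-monoˡ-≤ M ∑α≤∑β ⟩
    ∑ β ys * M             ≡⟨ ∑-*ʳ M β ys ⟩
    ∑[ y ← ys ] β y * M    ≤⟨ ∑-mono-≤ (All.map (λ {y} → *-monoʳ-≤ (β y)) M≤w) ⟩
    ∑[ y ← ys ] β y * w y  ∎
    where
      open ≤-Reasoning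
      M : ℕ
      M = max 0 (map w xs)
      w≤M : All (λ x → w x ≤ M) xs
      w≤M = All.map⁻ (xs≤max 0 (map w xs))
      M≤w : All (λ y → M ≤ w y) ys
      M≤w = All.map (λ xs≤y → max≤v⁺ z≤n (All.map⁺ xs≤y)) ys≥xs

  -- Each bad element of rest is charged to a distinct good element of big,
  -- which is at least as heavy.
  ∑-rest≤∑-good : ∀ (good : A → Bool) {ps big rest} → ps ↭ big ++ rest →
                  All (λ b → All (λ c → w c ≤ w b) rest) big →
                  ∑[ p ← ps ] ⟦ not (good p) ⟧ ≤ length big →
                  ∑ w rest ≤ ∑[ p ← ps ] ⟦ good p ⟧ * w p
  ∑-rest≤∑-good good {ps} {big} {rest} ps↭ big≥rest few-bad = begin
    ∑ w rest                   ≡⟨ ∑-cong (λ p → ⟦⟧*-split (good p) (w p)) rest ⟩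
    ∑[ p ← rest ] (g p + b p)  ≡⟨ ∑-+ g b rest ⟩
    ∑ g rest + ∑ b rest        ≤⟨ +-monoʳ-≤ (∑ g rest) b-rest≤g-big ⟩
    ∑ g rest + ∑ g big         ≡⟨ +-comm (∑ g rest) (∑ g big) ⟩
    ∑ g big + ∑ g rest         ≡⟨ sym (∑-++ g big rest) ⟩
    ∑ g (big ++ rest)          ≡⟨ sym (∑-↭ g ps↭) ⟩
    ∑ g ps                     ∎
    where
      open ≤-Reasoning
      #good #bad g b : A → ℕ
      #good p = ⟦ good p ⟧
      #bad p = ⟦ not (good p) ⟧
      g p = #good p * w p
      b p = #bad p * w p
      #bad-rest≤#good-big : ∑ #bad rest ≤ ∑ #good big
      #bad-rest≤#good-big = +-cancelˡ-≤ (∑ #bad big) (∑ #bad rest) (∑ #good big) (begin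
        ∑ #bad big + ∑ #bad rest         ≡⟨ sym (∑-++ #bad big rest) ⟩
        ∑ #bad (big ++ rest)             ≡⟨ sym (∑-↭ #bad ps↭) ⟩
        ∑ #bad ps                        ≤⟨ few-bad ⟩
        length big                       ≡⟨ sym (∑-const-1 big) ⟩
        ∑[ _ ← big ] 1                   ≡⟨ ∑-cong (λ p → sym (⟦not⟧+⟦⟧≡1 (good p))) big ⟩
        ∑[ p ← big ] (#bad p + #good p)  ≡⟨ ∑-+ #bad #good big ⟩
        ∑ #bad big + ∑ #good big         ∎)
      b-rest≤g-big : ∑ b rest ≤ ∑ g big
      b-rest≤g-big = ∑-*-dominated #bad #good big≥rest #bad-rest≤#good-big

module _ {L : ℕ} where

  ≤ᴸ-refl : (a : Layer L) → T (a ≤ᴸ a)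
  ≤ᴸ-refl (fin i) = ≤⇒≤ᵇ (≤-refl {toℕ i})
  ≤ᴸ-refl ∞       = _

  ≤-<ᴸ-trans : (a b c : Layer L) → T (a ≤ᴸ b) → T (b <ᴸ c) → T (a ≤ᴸ c)
  ≤-<ᴸ-trans (fin i) (fin j) (fin k) i≤j j<k =
    ≤⇒≤ᵇ (≤-trans (≤ᵇ⇒≤ (toℕ i) (toℕ j) i≤j) (<⇒≤ (<ᵇ⇒< (toℕ j) (toℕ k) j<k)))
  ≤-<ᴸ-trans (fin i) (fin j) ∞       _ _ = _
  ≤-<ᴸ-trans (fin i) ∞       _       _ ()
  ≤-<ᴸ-trans ∞       (fin j) _       () _
  ≤-<ᴸ-trans ∞       ∞       _       _ ()

  <ᴸ⇒≱ᴸ : (a b : Layer L) → T (a <ᴸ b) → ¬ T (b ≤ᴸ a)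
  <ᴸ⇒≱ᴸ (fin i) (fin j) i<j j≤i =
    <⇒≱ (<ᵇ⇒< (toℕ i) (toℕ j) i<j) (≤ᵇ⇒≤ (toℕ j) (toℕ i) j≤i)
  <ᴸ⇒≱ᴸ (fin i) ∞       _   ()

  ≮ᴸ⇒≥ᴸ : (a b : Layer L) → ¬ T (a <ᴸ b) → T (b ≤ᴸ a)
  ≮ᴸ⇒≥ᴸ (fin i) (fin j) i≮j = ≤⇒≤ᵇ {toℕ j} {toℕ i} (≮⇒≥ (i≮j ∘ <⇒<ᵇ))
  ≮ᴸ⇒≥ᴸ (fin i) ∞       i≮∞ = ⊥-elim (i≮∞ _)
  ≮ᴸ⇒≥ᴸ ∞       (fin j) _   = _
  ≮ᴸ⇒≥ᴸ ∞       ∞       _   = _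

  <ᴸ⇒≢∞ : (a b : Layer L) → T (a <ᴸ b) → a ≢ ∞
  <ᴸ⇒≢∞ (fin i) _ _ ()

  ≢∞⇒<ᴸ∞ : (a : Layer L) → a ≢ ∞ → T (a <ᴸ ∞)
  ≢∞⇒<ᴸ∞ (fin i) _   = _
  ≢∞⇒<ᴸ∞ ∞       a≢∞ = a≢∞ refl

module PathCounting (G : Graph) {L : ℕ} (ℓ : Fin (n G) → Layer L) where

  private
    V : Set
    V = Fin (n G)

    vertices : List V
    vertices = allFin (n G)

    seqs : ℕ → List (List V)
    seqs = seqsOfLength G ℓ

  isIncPathTo : V → List V → Bool
  isIncPathTo v []       = false
  isIncPathTo v (x ∷ xs) = incPathFrom G ℓ x xs v

  numPathsOfLength≡∑ : ∀ v m → numPathsOfLength G ℓ v m ≡ ∑[ xs ← seqs m ] ⟦ isIncPathTo v xs ⟧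
  numPathsOfLength≡∑ v m =
    trans (countᵇ≡∑ _ (seqs m)) (∑-cong (λ { [] → refl ; (_ ∷ _) → refl }) (seqs m))

  ∑-seqs-∷ : ∀ m (f : List V → ℕ) →
             ∑ f (seqs (suc m)) ≡ ∑[ x ← vertices ] ∑[ xs ← seqs m ] f (x ∷ xs)
  ∑-seqs-∷ m f = begin
    ∑ f (concat (map prefixed vertices))
      ≡⟨ ∑-concat f (map prefixed vertices) ⟩
    ∑ (∑ f) (map prefixed vertices)
      ≡⟨ ∑-map (∑ f) prefixed vertices ⟩
    ∑[ x ← vertices ] ∑ f (prefixed x)
      ≡⟨ ∑-cong (λ x → ∑-map f (x ∷_) (seqs m)) vertices ⟩
    ∑[ x ← vertices ] ∑[ xs ← seqs m ] f (x ∷ xs) ∎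
    where
      open ≡-Reasoning
      prefixed : V → List (List V)
      prefixed x = map (x ∷_) (seqs m)

  ∑-seqs-∷ʳ : ∀ m (f : List V → ℕ) →
              ∑ f (seqs (suc m)) ≡ ∑[ y ← vertices ] ∑[ xs ← seqs m ] f (xs ∷ʳ y)
  ∑-seqs-∷ʳ zero    f = ∑-seqs-∷ zero f
  ∑-seqs-∷ʳ (suc m) f = begin
    ∑ f (seqs (suc (suc m)))
      ≡⟨ ∑-seqs-∷ (suc m) f ⟩
    ∑[ x ← vertices ] ∑[ xs ← seqs (suc m) ] f (x ∷ xs)
      ≡⟨ ∑-cong (λ x → ∑-seqs-∷ʳ m (f ∘ (x ∷_))) vertices ⟩
    ∑[ x ← vertices ] ∑[ y ← vertices ] ∑[ xs ← seqs m ] f (x ∷ xs ∷ʳ y)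
      ≡⟨ ∑-comm (λ x y → ∑[ xs ← seqs m ] f (x ∷ xs ∷ʳ y)) vertices vertices ⟩
    ∑[ y ← vertices ] ∑[ x ← vertices ] ∑[ xs ← seqs m ] f (x ∷ xs ∷ʳ y)
      ≡⟨ ∑-cong (λ y → sym (∑-seqs-∷ m (λ zs → f (zs ∷ʳ y)))) vertices ⟩
    ∑[ y ← vertices ] ∑[ zs ← seqs (suc m) ] f (zs ∷ʳ y) ∎
    where open ≡-Reasoning

  ∑-seqs-vanish : ∀ m (f : List V → ℕ) → (∀ xs → length xs ≡ m → f xs ≡ 0) → ∑ f (seqs m) ≡ 0
  ∑-seqs-vanish zero    f f≡0 = trans (+-identityʳ (f [])) (f≡0 [] refl)
  ∑-seqs-vanish (suc m) f f≡0 = trans (∑-seqs-∷ m f) (∑-zero (All.universal vanish vertices))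
    where
      vanish : ∀ x → ∑[ xs ← seqs m ] f (x ∷ xs) ≡ 0
      vanish x = ∑-seqs-vanish m (f ∘ (x ∷_)) (λ xs len≡m → f≡0 (x ∷ xs) (cong suc len≡m))

  pathEnd : V → List V → V
  pathEnd x []       = x
  pathEnd _ (y ∷ ys) = pathEnd y ys

  incPath-∷⁻ : ∀ x y ys {v} → T (incPathFrom G ℓ x (y ∷ ys) v) →
               T (adj G x y) × T (ℓ x <ᴸ ℓ y) × T (incPathFrom G ℓ y ys v)
  incPath-∷⁻ x y ys path = let xy , rest = T-∧⁻ (adj G x y) path in xy , T-∧⁻ (ℓ x <ᴸ ℓ y) rest

  incPath-end : ∀ x xs {v} → T (incPathFrom G ℓ x xs v) → v ≡ pathEnd x xs
  incPath-end x []       {v} path = sym (toWitness {a? = x ≟ v} (proj₂ (T-∧⁻ (ℓ x <ᴸ ∞) path)))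
  incPath-end x (y ∷ ys)     path = incPath-end y ys (proj₂ (proj₂ (incPath-∷⁻ x y ys path)))

  incPath-∷ʳ : ∀ x xs {u v} → T (incPathFrom G ℓ x xs u) →
               T (adj G u v) → T (ℓ u <ᴸ ℓ v) → T (ℓ v <ᴸ ∞) → T (incPathFrom G ℓ x (xs ∷ʳ v) v)
  incPath-∷ʳ x [] path uv u<v v<∞ with incPath-end x [] path
  ... | refl = T-∧⁺ (uv , T-∧⁺ (u<v , T-∧⁺ (v<∞ , fromWitness refl)))
  incPath-∷ʳ x (y ∷ ys) path uv u<v v<∞ with incPath-∷⁻ x y ys path
  ... | xy , x<y , path′ = T-∧⁺ (xy , T-∧⁺ (x<y , incPath-∷ʳ y ys path′ uv u<v v<∞))

  -- rank takes values in [1, n] and strictly increases along an increasing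
  -- path, so such a path has at most n vertices.
  rank : V → ℕ
  rank x = ∑[ w ← vertices ] ⟦ ℓ w ≤ᴸ ℓ x ⟧

  rank-positive : ∀ x → 1 ≤ rank x
  rank-positive x = begin
    1                  ≡⟨ sym (⟦⟧-true (≤ᴸ-refl (ℓ x))) ⟩
    ⟦ ℓ x ≤ᴸ ℓ x ⟧     ≤⟨ ∑-∈ (λ w → ⟦ ℓ w ≤ᴸ ℓ x ⟧) (∈-allFin x) ⟩
    rank x             ∎
    where open ≤-Reasoning

  rank≤n : ∀ x → rank x ≤ n G
  rank≤n x =
    ≤-trans (∑⟦⟧≤length (λ w → ℓ w ≤ᴸ ℓ x) vertices) (≤-reflexive (length-tabulate (λ i → i)))

  rank-mono-< : ∀ x y → T (ℓ x <ᴸ ℓ y) → rank x < rank y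
  rank-mono-< x y x<y =
    ∑-mono-< (All.universal below-x⇒below-y vertices) (∈-allFin y) y-counts-only-for-y
    where
      below-x⇒below-y : ∀ w → ⟦ ℓ w ≤ᴸ ℓ x ⟧ ≤ ⟦ ℓ w ≤ᴸ ℓ y ⟧
      below-x⇒below-y w = ⟦⟧-mono (λ w≤x → ≤-<ᴸ-trans (ℓ w) (ℓ x) (ℓ y) w≤x x<y)
      y-counts-only-for-y : ⟦ ℓ y ≤ᴸ ℓ x ⟧ < ⟦ ℓ y ≤ᴸ ℓ y ⟧
      y-counts-only-for-y =
        subst₂ _<_ (sym (⟦⟧-false (<ᴸ⇒≱ᴸ (ℓ x) (ℓ y) x<y))) (sym (⟦⟧-true (≤ᴸ-refl (ℓ y)))) z<s

  incPath-length : ∀ x xs {v} → T (incPathFrom G ℓ x xs v) → length xs + rank x ≤ n G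
  incPath-length x []       _    = rank≤n x
  incPath-length x (y ∷ ys) path with incPath-∷⁻ x y ys path
  ... | _ , x<y , path′ = begin
    suc (length ys) + rank x  ≡⟨ sym (+-suc (length ys) (rank x)) ⟩
    length ys + suc (rank x)  ≤⟨ +-monoʳ-≤ (length ys) (rank-mono-< x y x<y) ⟩
    length ys + rank y        ≤⟨ incPath-length y ys path′ ⟩
    n G                       ∎
    where open ≤-Reasoning

  numPathsOfLength-1 : ∀ v → T (ℓ v <ᴸ ∞) → 1 ≤ numPathsOfLength G ℓ v 1
  numPathsOfLength-1 v v<∞ = begin
    1
      ≡⟨ sym (⟦⟧-true {isIncPathTo v [ v ]} (T-∧⁺ (v<∞ , fromWitness refl))) ⟩
    ⟦ isIncPathTo v [ v ] ⟧
      ≤⟨ m≤m+n _ 0 ⟩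
    ⟦ isIncPathTo v [ v ] ⟧ + 0
      ≤⟨ ∑-∈ (λ x → ⟦ isIncPathTo v [ x ] ⟧ + 0) (∈-allFin v) ⟩
    ∑[ x ← vertices ] ∑[ xs ← seqs 0 ] ⟦ isIncPathTo v (x ∷ xs) ⟧
      ≡⟨ sym (∑-seqs-∷ 0 (λ xs → ⟦ isIncPathTo v xs ⟧)) ⟩
    ∑[ xs ← seqs 1 ] ⟦ isIncPathTo v xs ⟧
      ≡⟨ sym (numPathsOfLength≡∑ v 1) ⟩
    numPathsOfLength G ℓ v 1 ∎
    where open ≤-Reasoning

  numPathsOfLength-suc-n≡0 : ∀ v → numPathsOfLength G ℓ v (suc (n G)) ≡ 0
  numPathsOfLength-suc-n≡0 v =
    trans (numPathsOfLength≡∑ v (suc (n G))) (∑-seqs-vanish (suc (n G)) _ tooLong)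
    where
      tooLong : ∀ xs → length xs ≡ suc (n G) → ⟦ isIncPathTo v xs ⟧ ≡ 0
      tooLong (x ∷ xs) len≡ = ⟦⟧-false λ path →
        <⇒≱ (subst (λ l → n G < l + rank x) (sym (suc-injective len≡)) (m<m+n (n G) (rank-positive x)))
            (incPath-length x xs path)

  module _ {v : V} (v<∞ : T (ℓ v <ᴸ ∞)) {U : List V} (U-unique : Unique U)
           (U⊆N[v] : All (λ u → T (adj G v u)) U) where

    -- xs is an increasing path to at most one u, its last vertex, and then
    -- xs ∷ʳ v is an increasing path to v.
    ∑-isIncPathTo≤isIncPathTo-∷ʳ : ∀ xs →
      ∑[ u ← U ] ⟦ ℓ u <ᴸ ℓ v ⟧ * ⟦ isIncPathTo u xs ⟧ ≤ ⟦ isIncPathTo v (xs ∷ʳ v) ⟧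
    ∑-isIncPathTo≤isIncPathTo-∷ʳ [] =
      ≤-trans (≤-reflexive (∑-zero (All.universal (λ u → *-zeroʳ ⟦ ℓ u <ᴸ ℓ v ⟧) U))) z≤n
    ∑-isIncPathTo≤isIncPathTo-∷ʳ (x ∷ xs) = begin
      ∑[ u ← U ] ⟦ ℓ u <ᴸ ℓ v ⟧ * ⟦ incPathFrom G ℓ x xs u ⟧
        ≤⟨ ∑-mono-≤ (All.map only-at-end U⊆N[v]) ⟩
      ∑[ u ← U ] isEnd u * extended
        ≡⟨ sym (∑-*ʳ extended isEnd U) ⟩
      (∑[ u ← U ] isEnd u) * extended
        ≤⟨ *-monoˡ-≤ extended (∑-Unique-≟≤1 _≟_ U-unique (pathEnd x xs)) ⟩
      1 * extended
        ≡⟨ *-identityˡ extended ⟩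
      extended ∎
      where
        open ≤-Reasoning
        isEnd : V → ℕ
        isEnd u = ⟦ ⌊ u ≟ pathEnd x xs ⌋ ⟧
        extended : ℕ
        extended = ⟦ incPathFrom G ℓ x (xs ∷ʳ v) v ⟧
        only-at-end : ∀ {u} → T (adj G v u) →
                      ⟦ ℓ u <ᴸ ℓ v ⟧ * ⟦ incPathFrom G ℓ x xs u ⟧ ≤ isEnd u * extended
        only-at-end {u} vu = ⟦⟧*-mono λ u<v path →
          fromWitness {a? = u ≟ pathEnd x xs} (incPath-end x xs path) ,
          incPath-∷ʳ x xs path (subst T (Graph.sym G v u) vu) u<v v<∞

    ∑-numPathsOfLength≤numPathsOfLength-suc : ∀ m →
      ∑[ u ← U ] ⟦ ℓ u <ᴸ ℓ v ⟧ * numPathsOfLength G ℓ u (suc m)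
        ≤ numPathsOfLength G ℓ v (suc (suc m))
    ∑-numPathsOfLength≤numPathsOfLength-suc m = begin
      ∑[ u ← U ] ⟦ ℓ u <ᴸ ℓ v ⟧ * P u (suc m)
        ≡⟨ ∑-cong (λ u → trans (cong (⟦ ℓ u <ᴸ ℓ v ⟧ *_) (numPathsOfLength≡∑ u (suc m)))
                               (∑-*ˡ ⟦ ℓ u <ᴸ ℓ v ⟧ _ S)) U ⟩
      ∑[ u ← U ] ∑[ xs ← S ] ⟦ ℓ u <ᴸ ℓ v ⟧ * ⟦ isIncPathTo u xs ⟧
        ≡⟨ ∑-comm (λ u xs → ⟦ ℓ u <ᴸ ℓ v ⟧ * ⟦ isIncPathTo u xs ⟧) U S ⟩
      ∑[ xs ← S ] ∑[ u ← U ] ⟦ ℓ u <ᴸ ℓ v ⟧ * ⟦ isIncPathTo u xs ⟧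
        ≤⟨ ∑-mono-≤ (All.universal ∑-isIncPathTo≤isIncPathTo-∷ʳ S) ⟩
      ∑[ xs ← S ] ⟦ isIncPathTo v (xs ∷ʳ v) ⟧
        ≤⟨ ∑-∈ (λ y → ∑[ xs ← S ] ⟦ isIncPathTo v (xs ∷ʳ y) ⟧) (∈-allFin v) ⟩
      ∑[ y ← vertices ] ∑[ xs ← S ] ⟦ isIncPathTo v (xs ∷ʳ y) ⟧
        ≡⟨ sym (∑-seqs-∷ʳ (suc m) (λ xs → ⟦ isIncPathTo v xs ⟧)) ⟩
      ∑[ xs ← seqs (suc (suc m)) ] ⟦ isIncPathTo v xs ⟧
        ≡⟨ sym (numPathsOfLength≡∑ v (suc (suc m))) ⟩
      P v (suc (suc m)) ∎
      where
        open ≤-Reasoning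
        P = numPathsOfLength G ℓ
        S = seqs (suc m)

    ∑-NumPathsIn<NumPathsIn : ∑[ u ← U ] ⟦ ℓ u <ᴸ ℓ v ⟧ * NumPathsIn G ℓ u < NumPathsIn G ℓ v
    ∑-NumPathsIn<NumPathsIn = begin
      1 + ∑[ u ← U ] ⟦ ℓ u <ᴸ ℓ v ⟧ * NumPathsIn G ℓ u
        ≡⟨ cong suc (∑-cong (λ u → ∑-*ˡ ⟦ ℓ u <ᴸ ℓ v ⟧ (P u ∘ suc) (upTo (n G))) U) ⟩
      1 + ∑[ u ← U ] ∑[ m ← upTo (n G) ] ⟦ ℓ u <ᴸ ℓ v ⟧ * P u (suc m)
        ≡⟨ cong suc (∑-comm (λ u m → ⟦ ℓ u <ᴸ ℓ v ⟧ * P u (suc m)) U (upTo (n G))) ⟩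
      1 + ∑[ m ← upTo (n G) ] ∑[ u ← U ] ⟦ ℓ u <ᴸ ℓ v ⟧ * P u (suc m)
        ≤⟨ +-mono-≤ (numPathsOfLength-1 v v<∞)
                    (∑-mono-≤ (All.universal ∑-numPathsOfLength≤numPathsOfLength-suc (upTo (n G)))) ⟩
      P v 1 + ∑[ m ← upTo (n G) ] P v (suc (suc m))
        ≡⟨ sym (∑-upTo-suc (P v ∘ suc) (n G)) ⟩
      ∑[ m ← upTo (suc (n G)) ] P v (suc m)
        ≡⟨ ∑-upTo-∷ʳ (P v ∘ suc) (n G) ⟩
      NumPathsIn G ℓ v + P v (suc (n G))
        ≡⟨ cong (NumPathsIn G ℓ v +_) (numPathsOfLength-suc-n≡0 v) ⟩
      NumPathsIn G ℓ v + 0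
        ≡⟨ +-identityʳ _ ⟩
      NumPathsIn G ℓ v ∎
      where
        open ≤-Reasoning
        P = numPathsOfLength G ℓ

sizes≡∑ : ∀ {V : Set} (ts : List (LTree V)) → sizes ts ≡ ∑ size ts
sizes≡∑ []       = refl
sizes≡∑ (t ∷ ts) = cong (size t +_) (sizes≡∑ ts)

module _ {V : Set} {k : ℕ} where

  LocalPrune-label : ∀ {t t′ : LTree V} → LocalPrune k t t′ → label t′ ≡ label t
  LocalPrune-label (few _)                = refl
  LocalPrune-label (many _ _ _ _ _ _ _ _) = refl

  LocalPrune-labels : ∀ {ts ps : List (LTree V)} → Pointwise (LocalPrune k) ts ps →
                      map label ps ≡ map label ts
  LocalPrune-labels []              = refl
  LocalPrune-labels (t↦p ∷ ts↦ps) = cong₂ _∷_ (LocalPrune-label t↦p) (LocalPrune-labels ts↦ps)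

module _ (G : Graph) {L d : ℕ} {ℓ : Fin (n G) → Layer L}
         (ℓ-partial : IsPartialLayerAssignment G L d ℓ) where

  open PathCounting G ℓ

  ∑-notBelow≤d : ∀ {r U} → ℓ r ≢ ∞ → Unique U → All (λ u → T (adj G r u)) U →
                 ∑[ u ← U ] ⟦ not (ℓ u <ᴸ ℓ r) ⟧ ≤ d
  ∑-notBelow≤d {r} {U} r≢∞ U-unique U⊆N[r] = begin
    ∑[ u ← U ] ⟦ not (ℓ u <ᴸ ℓ r) ⟧
      ≤⟨ ∑-mono-≤ (All.map notBelow⇒outNeighbour U⊆N[r]) ⟩
    ∑[ u ← U ] ⟦ outNeighbour u ⟧
      ≤⟨ ∑-Unique-⊆ _≟_ (λ u → ⟦ outNeighbour u ⟧) U-unique (λ {u} _ → ∈-allFin u) ⟩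
    ∑[ u ← allFin (n G) ] ⟦ outNeighbour u ⟧
      ≡⟨ sym (countᵇ≡∑ outNeighbour (allFin (n G))) ⟩
    countᵇ outNeighbour (allFin (n G))
      ≤⟨ ℓ-partial r r≢∞ ⟩
    d ∎
    where
      open ≤-Reasoning
      outNeighbour : Fin (n G) → Bool
      outNeighbour u = adj G r u ∧ (ℓ r ≤ᴸ ℓ u)
      notBelow⇒outNeighbour : ∀ {u} → T (adj G r u) → ⟦ not (ℓ u <ᴸ ℓ r) ⟧ ≤ ⟦ outNeighbour u ⟧
      notBelow⇒outNeighbour {u} ru =
        ⟦⟧-mono λ u≮r → T-∧⁺ (ru , ≮ᴸ⇒≥ᴸ (ℓ u) (ℓ r) (T-not⇒¬T u≮r))

  module _ {k : ℕ} (d≤k : d ≤ k) where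

    mutual
      LocalPrune-size≤NumPathsIn : ∀ {t t′} → Valid G t → ℓ (label t) ≢ ∞ → LocalPrune k t t′ →
                                   size t′ ≤ NumPathsIn G ℓ (label t)
      LocalPrune-size≤NumPathsIn _ r≢∞ (few _) = ∑-NumPathsIn<NumPathsIn (≢∞⇒<ᴸ∞ _ r≢∞) [] []
      LocalPrune-size≤NumPathsIn {node r ts} (ts⊆N[r] , ts-unique , ts-valid) r≢∞
                                 (many ps big rest _ ts↦ps ps↭ |big|≡k big≥rest) = begin
        suc (sizes rest)
          ≡⟨ cong suc (sizes≡∑ rest) ⟩
        1 + ∑ size rest
          ≤⟨ +-monoʳ-≤ 1 (∑-rest≤∑-good size isBelow ps↭ big≥rest few-notBelow) ⟩
        1 + ∑[ p ← ps ] ⟦ isBelow p ⟧ * size p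
          ≤⟨ +-monoʳ-≤ 1 (∑-mono-≤ (All.map (λ IH → ⟦⟧*-monoʳ (IH ∘ <ᴸ⇒≢∞ _ _)) IHs)) ⟩
        1 + ∑[ p ← ps ] ⟦ isBelow p ⟧ * NumPathsIn G ℓ (label p)
          ≡⟨ cong suc (sym (∑-map (λ u → ⟦ ℓ u <ᴸ ℓ r ⟧ * NumPathsIn G ℓ u) label ps)) ⟩
        1 + ∑[ u ← map label ps ] ⟦ ℓ u <ᴸ ℓ r ⟧ * NumPathsIn G ℓ u
          ≤⟨ ∑-NumPathsIn<NumPathsIn (≢∞⇒<ᴸ∞ _ r≢∞) ps-unique ps⊆N[r] ⟩
        NumPathsIn G ℓ r ∎
        where
          open ≤-Reasoning
          isBelow : LTree (Fin (n G)) → Bool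
          isBelow p = ℓ (label p) <ᴸ ℓ r
          IHs = LocalPrune-sizes≤NumPathsIn ts-valid ts↦ps
          ps-unique : Unique (map label ps)
          ps-unique = subst Unique (sym (LocalPrune-labels ts↦ps)) ts-unique
          ps⊆N[r] : All (λ u → T (adj G r u)) (map label ps)
          ps⊆N[r] = subst (All _) (sym (LocalPrune-labels ts↦ps))
                          (All.map⁺ (All.map (Equivalence.from T-≡) ts⊆N[r]))
          few-notBelow : ∑[ p ← ps ] ⟦ not (isBelow p) ⟧ ≤ length big
          few-notBelow = begin
            ∑[ p ← ps ] ⟦ not (isBelow p) ⟧
              ≡⟨ sym (∑-map (λ u → ⟦ not (ℓ u <ᴸ ℓ r) ⟧) label ps) ⟩
            ∑[ u ← map label ps ] ⟦ not (ℓ u <ᴸ ℓ r) ⟧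
              ≤⟨ ∑-notBelow≤d r≢∞ ps-unique ps⊆N[r] ⟩
            d
              ≤⟨ d≤k ⟩
            k
              ≡⟨ sym |big|≡k ⟩
            length big ∎

      LocalPrune-sizes≤NumPathsIn :
        ∀ {ts ps} → ValidAll G ts → Pointwise (LocalPrune k) ts ps →
        All (λ p → ℓ (label p) ≢ ∞ → size p ≤ NumPathsIn G ℓ (label p)) ps
      LocalPrune-sizes≤NumPathsIn _                    []              = []
      LocalPrune-sizes≤NumPathsIn (t-valid , ts-valid) (t↦p ∷ ts↦ps) =
        subst (λ u → ℓ u ≢ ∞ → _ ≤ NumPathsIn G ℓ u) (sym (LocalPrune-label t↦p))
              (λ t≢∞ → LocalPrune-size≤NumPathsIn t-valid t≢∞ t↦p)
        ∷ LocalPrune-sizes≤NumPathsIn ts-valid ts↦ps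

mainTheorem5 : (G : Graph) (T : LTree (Fin (n G))) → Valid G T →
    (L d : ℕ) → 1 ≤ L → 1 ≤ d →
    (ℓ : Fin (n G) → Layer L) → IsPartialLayerAssignment G L d ℓ →
    ¬ (ℓ (label T) ≡ ∞) →
    (k : ℕ) → 1 ≤ k → d ≤ k →
    (Tp : LTree (Fin (n G))) → LocalPrune k T Tp →
    size Tp ≤ NumPathsIn G ℓ (label T)
mainTheorem5 G _ valid _ _ _ _ _ ℓ-partial root≢∞ _ _ d≤k _ prune =
  LocalPrune-size≤NumPathsIn G ℓ-partial d≤k valid root≢∞ prune
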